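{- Let $p\ge5$, $A=\mathbb Z_p^3$, $\Omega=(0,1,2)$, $\eta=1+p\Omega$, so that $\bar\eta=1$ ($P=1$) and $\omega=\bar\Omega$. For every $Q(X)=A_0+B_0X+C_0\binom X2\in\mathbb F_p[X]$ with $C_0\ne0$, there exists $\gamma\in A\setminus pA$ such that, with $x_0=\bar\gamma$: $x_0\ne0$, $\operatorname{Tr}(x_0)=0$, $\operatorname{Tr}(x_0\omega)=0$, $\operatorname{Tr}_A(\gamma)\in p^2\mathbb Z_p$, $\operatorname{Tr}_A(\gamma\Omega)\in p\mathbb Z_p$, and \[ \frac{\operatorname{Tr}_A(\gamma)}{p^2}+\frac{\operatorname{Tr}_A(\gamma\Omega)}{p}X+\operatorname{Tr}(x_0\omega^2)\binom X2\equiv Q(X)\pmod p. \] That is, the unique mod-$p$ class $a=0$ is primitive first-order singular with quadratic Hensel polynomial exactly $Q$.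
   Context: Traces of $\mathbb F_p^3/\mathbb F_p$ and $\mathbb Z_p^3/\mathbb Z_p$ are sums of coordinates. For the branch $F_0(t)=\operatorname{Tr}_A(\gamma\eta^t)$, the quadratic Hensel polynomial of a primitive first-order singular class is $A_0+B_0X+\Delta\binom X2$ with $A_0\equiv\operatorname{Tr}_A(\gamma)/p^2$, $B_0\equiv\operatorname{Tr}_A(\gamma U)/p$, $\Delta=\operatorname{Tr}(\bar\gamma\omega^2)$, where $\eta=1+pU$ (here $U=\Omega$). -}

module Defs where

open import Data.Nat as ℕ using (ℕ)
open import Data.Integer using (ℤ; +_; _+_; _-_; _*_)
open import Data.Integer.Divisibility using (_∣_)
open import Data.Product using (_×_; _,_)
open import Relation.Nullary using (¬_)

-- Elements of A = Z_p^3 are represented by their integer points ℤ × ℤ × ℤ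
--.  A is a product ring: multiplication is
-- coordinatewise.
A³ : Set
A³ = ℤ × ℤ × ℤ

_⊙_ : A³ → A³ → A³
(a₀ , a₁ , a₂) ⊙ (b₀ , b₁ , b₂) = (a₀ * b₀ , a₁ * b₁ , a₂ * b₂)

Tr : A³ → ℤ
Tr (a₀ , a₁ , a₂) = a₀ + a₁ + a₂

Ω : A³
Ω = (+ 0 , + 1 , + 2)

-- Congruence modulo p in ℤ (equality of reductions in F_p).
_≡_[mod_] : ℤ → ℤ → ℕ → Set
a ≡ b [mod p ] = (+ p) ∣ (a - b)

-- γ ∈ pA  ⇔  every coordinate divisible by p  ⇔  reduction γ̄ = 0 in F_p^3.
InPA : ℕ → A³ → Set
InPA p (a₀ , a₁ , a₂) = (a₀ ≡ + 0 [mod p ]) × (a₁ ≡ + 0 [mod p ]) × (a₂ ≡ + 0 [mod p ])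

ReductionNonzero : ℕ → A³ → Set
ReductionNonzero p γ = ¬ InPA p γ

-- Any prime p ≥ 5 is odd, so 2 has an inverse h = (p + 1)/2 modulo p.  The point
-- γ = (p²A₀ − pB₀ + hC₀ , pB₀ − 2hC₀ , hC₀) of ℤ³ then has Tr γ = p²A₀ and
-- Tr (γΩ) = pB₀ exactly, while Tr (γΩ²) = pB₀ + 2hC₀ ≡ C₀ (mod p).  Since the
-- trace form Tr (γ x) vanishes mod p whenever γ ∈ pA, the last congruence and
-- C₀ ≢ 0 force γ ∉ pA.
module Submission where

open import Defs
open import Data.Nat using (ℕ; _≤_)
open import Data.Nat.Primality using (Prime)
open import Data.Integer using (ℤ; +_; _*_; _^_)
open import Data.Product using (_×_; Σ-syntax)
open import Relation.Nullary using (¬_)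
open import Relation.Binary.PropositionalEquality using (_≡_)

import Data.Nat as ℕ
import Data.Nat.Divisibility as ℕ
open import Data.Nat.Primality using (prime⇒irreducible)
open import Data.Nat.Properties using (≤-trans; >⇒≢)
open import Data.Integer using (_+_; _-_; -_)
open import Data.Integer.Properties as ℤ using (pos-*)
open import Data.Integer.Divisibility.Signed as Signed
  using (divides; ∣⇒∣ᵤ; ∣ᵤ⇒∣; ∣m⇒∣-m; ∣m∣n⇒∣m+n; ∣m⇒∣m*n)
open import Data.Integer.Tactic.RingSolver using (solve-∀)
open import Data.Product using (_,_; ∃; proj₁; proj₂)
open import Data.Empty using (⊥-elim)
open import Data.Sum using (_⊎_; inj₁; inj₂)
open import Relation.Binary.PropositionalEquality using (refl; cong; sym; trans; subst; _≢_; module ≡-Reasoning)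

private
  variable
    p : ℕ
    a b c : ℤ

even⊎odd : ∀ n → ∃ λ q → n ≡ q ℕ.* 2 ⊎ n ≡ ℕ.suc (q ℕ.* 2)
even⊎odd ℕ.zero = 0 , inj₁ refl
even⊎odd (ℕ.suc n) with even⊎odd n
... | q , inj₁ n≡2q   = q , inj₂ (cong ℕ.suc n≡2q)
... | q , inj₂ n≡1+2q = ℕ.suc q , inj₁ (cong ℕ.suc n≡1+2q)

prime≢2⇒odd : Prime p → p ≢ 2 → ∃ λ q → p ≡ ℕ.suc (q ℕ.* 2)
prime≢2⇒odd {p} pr p≢2 with even⊎odd p
... | q , inj₂ p≡1+2q = q , p≡1+2q
... | q , inj₁ p≡2q with prime⇒irreducible pr (ℕ.divides q p≡2q)
...   | inj₁ ()
...   | inj₂ 2≡p = ⊥-elim (p≢2 (sym 2≡p))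

fromSigned : + p Signed.∣ a - b → a ≡ b [mod p ]
fromSigned {p = p} {a = a} {b = b} = ∣⇒∣ᵤ {+ p} {a - b}

toSigned : a ≡ b [mod p ] → + p Signed.∣ a - b
toSigned {a = a} {b = b} {p = p} = ∣ᵤ⇒∣ {+ p} {a - b}

≡[mod]-refl : a ≡ a [mod p ]
≡[mod]-refl {a = a} {p = p} = fromSigned {a = a} {b = a} (divides (+ 0) (a-a≡0*p a (+ p)))
  where
  a-a≡0*p : ∀ a p → a - a ≡ + 0 * p
  a-a≡0*p = solve-∀

≡[mod]-sym : a ≡ b [mod p ] → b ≡ a [mod p ]
≡[mod]-sym {a = a} {b = b} {p = p} a≡b =
  fromSigned {a = b} {b = a} (subst (+ p Signed.∣_) (negate-diff a b) (∣m⇒∣-m (toSigned {a = a} a≡b)))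
  where
  negate-diff : ∀ a b → - (a - b) ≡ b - a
  negate-diff = solve-∀

≡[mod]-trans : a ≡ b [mod p ] → b ≡ c [mod p ] → a ≡ c [mod p ]
≡[mod]-trans {a = a} {b = b} {p = p} {c = c} a≡b b≡c = fromSigned {a = a} {b = c}
  (subst (+ p Signed.∣_) (telescope a b c) (∣m∣n⇒∣m+n (toSigned {a = a} a≡b) (toSigned {a = b} b≡c)))
  where
  telescope : ∀ a b c → (a - b) + (b - c) ≡ a - c
  telescope = solve-∀

≡+multiple⇒≡[mod] : ∀ k → a ≡ b + k * + p → a ≡ b [mod p ]
≡+multiple⇒≡[mod] {a = a} {b = b} {p = p} k a≡b+kp =
  fromSigned {a = a} {b = b} (divides k (trans (cong (_- b) a≡b+kp) (cancel b (k * + p))))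
  where
  cancel : ∀ b m → (b + m) - b ≡ m
  cancel = solve-∀

private
  a-0≡a : ∀ a → a - + 0 ≡ a
  a-0≡a = solve-∀

≡0[mod]⇒∣ : a ≡ + 0 [mod p ] → + p Signed.∣ a
≡0[mod]⇒∣ {a = a} {p = p} a≡0 = subst (+ p Signed.∣_) (a-0≡a a) (toSigned {a = a} {b = + 0} a≡0)

∣⇒≡0[mod] : + p Signed.∣ a → a ≡ + 0 [mod p ]
∣⇒≡0[mod] {p = p} {a = a} p∣a = fromSigned {a = a} {b = + 0} (subst (+ p Signed.∣_) (sym (a-0≡a a)) p∣a)

InPA⇒Tr-⊙≡0 : ∀ {γ} → InPA p γ → ∀ x → Tr (γ ⊙ x) ≡ + 0 [mod p ]
InPA⇒Tr-⊙≡0 {γ = γ₀ , γ₁ , γ₂} (γ₀≡0 , γ₁≡0 , γ₂≡0) (x₀ , x₁ , x₂) = ∣⇒≡0[mod]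
  (∣m∣n⇒∣m+n (∣m∣n⇒∣m+n (∣m⇒∣m*n x₀ (≡0[mod]⇒∣ {a = γ₀} γ₀≡0))
                          (∣m⇒∣m*n x₁ (≡0[mod]⇒∣ {a = γ₁} γ₁≡0)))
              (∣m⇒∣m*n x₂ (≡0[mod]⇒∣ {a = γ₂} γ₂≡0)))

prime≢2⇒2-invertible : Prime p → p ≢ 2 → Σ[ h ∈ ℤ ] ((+ 2 * h) ≡ + 1 [mod p ])
prime≢2⇒2-invertible pr p≢2 with prime≢2⇒odd pr p≢2
... | q , refl = + ℕ.suc q , fromSigned {a = + 2 * + ℕ.suc q} {b = + 1} (divides (+ 1) 2[1+q]-1≡1+2q)
  where
  identity : ∀ x → + 2 * (+ 1 + x) - + 1 ≡ + 1 * (+ 1 + x * + 2)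
  identity = solve-∀

  2[1+q]-1≡1+2q : + 2 * + ℕ.suc q - + 1 ≡ + 1 * + ℕ.suc (q ℕ.* 2)
  2[1+q]-1≡1+2q = trans (identity (+ q)) (cong (λ m → + 1 * (+ 1 + m)) (sym (pos-* q 2)))

henselWitness : ℕ → ℤ → ℤ → ℤ → ℤ → A³
henselWitness p h A B C = (+ p * + p * A - + p * B + h * C , + p * B - + 2 * (h * C) , h * C)

module HenselWitness (p : ℕ) (h A B C : ℤ) where

  Tr-henselWitness : Tr (henselWitness p h A B C) ≡ (+ p) ^ 2 * A
  Tr-henselWitness = identity (+ p) h A B C
    where
    -- (+ p) ^ 2 unfolds to + p * (+ p * + 1); the solver does not handle _^_.
    identity : ∀ P h A B C → (P * P * A - P * B + h * C) + (P * B - + 2 * (h * C)) + h * C ≡ P * (P * + 1) * A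
    identity = solve-∀

  Tr-henselWitness-⊙Ω : Tr (henselWitness p h A B C ⊙ Ω) ≡ + p * B
  Tr-henselWitness-⊙Ω = identity (+ p) h A B C
    where
    identity : ∀ P h A B C →
      (P * P * A - P * B + h * C) * + 0 + (P * B - + 2 * (h * C)) * + 1 + (h * C) * + 2 ≡ P * B
    identity = solve-∀

  Tr-henselWitness-⊙Ω² : Tr (henselWitness p h A B C ⊙ (Ω ⊙ Ω)) ≡ C + (+ 2 * h - + 1) * C + + p * B
  Tr-henselWitness-⊙Ω² = identity (+ p) h A B C
    where
    identity : ∀ P h A B C →
      (P * P * A - P * B + h * C) * (+ 0 * + 0) + (P * B - + 2 * (h * C)) * (+ 1 * + 1) + (h * C) * (+ 2 * + 2)
        ≡ C + (+ 2 * h - + 1) * C + P * B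
    identity = solve-∀

  Tr-henselWitness-⊙Ω²≡C : (+ 2 * h) ≡ + 1 [mod p ] → Tr (henselWitness p h A B C ⊙ (Ω ⊙ Ω)) ≡ C [mod p ]
  Tr-henselWitness-⊙Ω²≡C 2h≡1 with toSigned {a = + 2 * h} {b = + 1} 2h≡1
  ... | divides k 2h-1≡kp = ≡+multiple⇒≡[mod] (k * C + B) (begin
    Tr (henselWitness p h A B C ⊙ (Ω ⊙ Ω)) ≡⟨ Tr-henselWitness-⊙Ω² ⟩
    C + (+ 2 * h - + 1) * C + + p * B      ≡⟨ cong (λ m → C + m * C + + p * B) 2h-1≡kp ⟩
    C + k * + p * C + + p * B              ≡⟨ identity C k (+ p) B ⟩
    C + (k * C + B) * + p                  ∎)
    where
    open ≡-Reasoning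
    identity : ∀ C k P B → C + k * P * C + P * B ≡ C + (k * C + B) * P
    identity = solve-∀

  henselWitness∉pA : ¬ C ≡ + 0 [mod p ] → (+ 2 * h) ≡ + 1 [mod p ] → ¬ InPA p (henselWitness p h A B C)
  henselWitness∉pA C≢0 2h≡1 γ∈pA = C≢0 (≡[mod]-trans {a = C} {b = T} {c = + 0}
    (≡[mod]-sym {a = T} (Tr-henselWitness-⊙Ω²≡C 2h≡1))
    (InPA⇒Tr-⊙≡0 {γ = henselWitness p h A B C} γ∈pA (Ω ⊙ Ω)))
    where
    T : ℤ
    T = Tr (henselWitness p h A B C ⊙ (Ω ⊙ Ω))

theorem3p26 : (p : ℕ) → Prime p → 5 ≤ p →
    (A₀ B₀ C₀ : ℤ) → ¬ (C₀ ≡ + 0 [mod p ]) →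
    Σ[ γ ∈ A³ ]
      ( ¬ InPA p γ
      × ReductionNonzero p γ
      × (Tr γ ≡ + 0 [mod p ])
      × (Tr (γ ⊙ Ω) ≡ + 0 [mod p ])
      × Σ[ a ∈ ℤ ] Σ[ b ∈ ℤ ]
          ( Tr γ ≡ (+ p) ^ 2 * a
          × Tr (γ ⊙ Ω) ≡ (+ p) * b
          × (a ≡ A₀ [mod p ])
          × (b ≡ B₀ [mod p ])
          × (Tr (γ ⊙ (Ω ⊙ Ω)) ≡ C₀ [mod p ]) ) )
theorem3p26 p pr 5≤p A₀ B₀ C₀ C₀≢0 =
  γ , γ∉pA , γ∉pA
  , ∣⇒≡0[mod] (divides (+ p * A₀) (trans Tr-henselWitness (p²A≡pA*p (+ p) A₀)))
  , ∣⇒≡0[mod] (divides B₀ (trans Tr-henselWitness-⊙Ω (ℤ.*-comm (+ p) B₀)))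
  , A₀ , B₀ , Tr-henselWitness , Tr-henselWitness-⊙Ω
  , ≡[mod]-refl {a = A₀} , ≡[mod]-refl {a = B₀} , Tr-henselWitness-⊙Ω²≡C 2h≡1
  where
  p≢2 : p ≢ 2
  p≢2 = >⇒≢ (≤-trans (ℕ.s≤s (ℕ.s≤s (ℕ.s≤s ℕ.z≤n))) 5≤p)

  h : ℤ
  h = proj₁ (prime≢2⇒2-invertible pr p≢2)

  2h≡1 : (+ 2 * h) ≡ + 1 [mod p ]
  2h≡1 = proj₂ (prime≢2⇒2-invertible pr p≢2)

  open HenselWitness p h A₀ B₀ C₀

  γ : A³
  γ = henselWitness p h A₀ B₀ C₀

  γ∉pA : ¬ InPA p γ
  γ∉pA = henselWitness∉pA C₀≢0 2h≡1

  p²A≡pA*p : ∀ P A → P * (P * + 1) * A ≡ (P * A) * P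
  p²A≡pA*p = solve-∀
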